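{- For all $n\ge 1$ and all $i,j\ge 0$, the number of permutations in $\mathcal{DRS}_n(132)$ with $i$ excedances and $j$ fixed points equals the number of permutations in $\mathcal{DRS}_n(213)$ with $i$ excedances and $j$ fixed points.
   Context: For $\sigma\in\mathfrak{S}_n$, a double descent is an index $i$ with $\sigma_i>\sigma_{i+1}>\sigma_{i+2}$. The permutation $\sigma$ is simsun if for every $k$, the subword of $\sigma$ consisting of the letters in $\{1,\dots,k\}$ (in the order they appear in $\sigma$) has no double descent. For $\omega\in\mathfrak{S}_t$, $\sigma$ contains an $\omega$-pattern if there are indices $i_1<\cdots<i_t$ with $\sigma_{i_j}<\sigma_{i_k}$ iff $\omega_j<\omega_k$; otherwise $\sigma$ avoids $\omega$. $\mathcal{DRS}_n(\omega)$ is the set of $\sigma\in\mathfrak{S}_n$ such that $\sigma$ is $\omega$-avoiding and simsun and $\sigma^{ -1}$ is simsun. An excedance of $\sigma$ is an index $i$ with $\sigma_i>i$; a fixed point is an index $i$ with $\sigma_i=i$. -}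

module Defs where

open import Data.Nat using (ℕ; zero; suc; _<ᵇ_; _≡ᵇ_; _≤ᵇ_)
open import Data.Bool using (Bool; true; false; _∧_; not; if_then_else_)
open import Data.Bool.Properties using () renaming (_≟_ to _≟B_)
open import Data.Product using (_×_; _,_)
open import Data.List using (List; []; _∷_; map; length; concatMap; applyUpTo; zip; _++_)
open import Data.Bool.ListAction using (all; any)
open import Relation.Nullary.Decidable using (⌊_⌋)

-- Permutations of [n] = {1,…,n} are represented in one-line notation as
-- lists σ = σ₁ σ₂ … σₙ of natural numbers (values and positions 1-based).

boolFilter : {A : Set} → (A → Bool) → List A → List A
boolFilter p []       = []
boolFilter p (x ∷ xs) = if p x then x ∷ boolFilter p xs else boolFilter p xs

range : ℕ → List ℕ
range n = applyUpTo suc n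

words : ℕ → ℕ → List (List ℕ)
words zero    n = [] ∷ []
words (suc k) n = concatMap (λ a → map (a ∷_) (words k n)) (range n)

distinct : List ℕ → Bool
distinct []       = true
distinct (x ∷ xs) = not (any (x ≡ᵇ_) xs) ∧ distinct xs

perms : ℕ → List (List ℕ)
perms n = boolFilter distinct (words n n)

subseqs : ℕ → List ℕ → List (List ℕ)
subseqs zero    _        = [] ∷ []
subseqs (suc t) []       = []
subseqs (suc t) (x ∷ xs) = map (x ∷_) (subseqs t xs) ++ subseqs (suc t) xs

orderIso : List ℕ → List ℕ → Bool
orderIso a ω = ⌊ length a Data.Nat.≟ length ω ⌋ ∧
  all (λ { (x , u) → all (λ { (y , v) → ⌊ (x <ᵇ y) ≟B (u <ᵇ v) ⌋ }) ps }) ps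
  where ps = zip a ω

contains : List ℕ → List ℕ → Bool
contains ω σ = any (λ a → orderIso a ω) (subseqs (length ω) σ)

avoids : List ℕ → List ℕ → Bool
avoids ω σ = not (contains ω σ)

hasDoubleDescent : List ℕ → Bool
hasDoubleDescent (x ∷ y ∷ z ∷ rest) =
  ((y <ᵇ x) ∧ (z <ᵇ y)) Data.Bool.∨ hasDoubleDescent (y ∷ z ∷ rest)
hasDoubleDescent _ = false

restrict : ℕ → List ℕ → List ℕ
restrict k σ = boolFilter (_≤ᵇ k) σ

-- σ ∈ 𝔖ₙ is simsun: for every k, σ restricted to [k] has no double descent
-- (k ranges over 0,…,n; for k ≥ n the restriction is σ itself)
simsun : ℕ → List ℕ → Bool
simsun n σ = all (λ k → not (hasDoubleDescent (restrict k σ))) (0 ∷ range n)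

positionOf : ℕ → List ℕ → ℕ
positionOf v []       = 0
positionOf v (x ∷ xs) = if v ≡ᵇ x then 1 else suc (positionOf v xs)

inverse : ℕ → List ℕ → List ℕ
inverse n σ = map (λ v → positionOf v σ) (range n)

isDRS : ℕ → List ℕ → List ℕ → Bool
isDRS n ω σ = avoids ω σ ∧ simsun n σ ∧ simsun n (inverse n σ)

indexed : List ℕ → List (ℕ × ℕ)
indexed σ = zip (range (length σ)) σ

exc : List ℕ → ℕ
exc σ = length (boolFilter (λ { (i , s) → i <ᵇ s }) (indexed σ))

fix : List ℕ → ℕ
fix σ = length (boolFilter (λ { (i , s) → i ≡ᵇ s }) (indexed σ))

countDRS : ℕ → List ℕ → ℕ → ℕ → ℕ
countDRS n ω i j = length (boolFilter
  (λ σ → isDRS n ω σ ∧ (exc σ ≡ᵇ i) ∧ (fix σ ≡ᵇ j)) (perms n))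

p132 : List ℕ
p132 = 1 ∷ 3 ∷ 2 ∷ []

p213 : List ℕ
p213 = 2 ∷ 1 ∷ 3 ∷ []

module Submission where

-- Let Φ(σ) = rc(σ⁻¹) be the reverse-complement of the inverse.  Φ is an
-- involution of 𝔖ₙ preserving excedances and fixed points, and it maps
-- DRSₙ(132) onto DRSₙ(213); counting along the bijection Φ proves the claim.
-- Avoidance is easy: 132 is its own inverse and rc turns it into 213.  For
-- the simsun conditions, σ is simsun iff it has no *low* double descent (a 321
-- at positions i < j < k all of whose other letters in between exceed σᵢ),
-- and rc exchanges low with *high* double descents (letters in between below
-- σₖ).  The heart is no-low⇔no-high: for 132-avoiding σ, neither σ nor σ⁻¹ has
-- a low double descent iff neither has a high one.  It goes through *clear*
-- 321s (no letter in between has a value inside the occurrence): clearness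
-- passes to inverses, double descents are clear, a clear 321 yields a low
-- double descent, and a low one yields a high one in σ or σ⁻¹.

open import Defs
open import Data.Bool using (Bool; true; false; T; T?; not; _∧_)
open import Data.Bool.Properties using (T-∧; T-∨; T-≡; T-not-≡)
open import Data.Empty using (⊥; ⊥-elim)
open import Data.Nat
open import Data.Nat.Properties
open import Data.Product using (Σ; ∃; ∃₂; _×_; _,_; proj₁; proj₂)
open import Data.Sum using (_⊎_; inj₁; inj₂; [_,_]′)
open import Data.Unit using (tt)
open import Data.Bool.ListAction using (any)
open import Data.List using (List; []; _∷_; map; length; filter; applyUpTo; zip)
open import Data.List.Properties
  using (map-∘; map-id-local; map-cong-local; map-applyUpTo; length-map; length-applyUpTo; ∷-injective; filter-notAll)
open import Data.List.Membership.Propositional using (_∈_; find; lose)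
open import Data.List.Membership.DecPropositional _≟_ using (_∈?_)
open import Data.List.Membership.Propositional.Properties
  using ( ∈-map⁺; ∈-map⁻; ∈-++⁺ˡ; ∈-++⁺ʳ; ∈-++⁻; ∈-applyUpTo⁺; ∈-applyUpTo⁻
        ; ∈-concatMap⁺; ∈-concatMap⁻; map∷⁻; ∈-filter⁺; ∈-filter⁻)
open import Data.List.Membership.Propositional.Properties.WithK using (unique∧set⇒bag)
open import Data.List.Relation.Unary.Any using (here; there)
open import Data.List.Relation.Unary.Any.Properties using (any⁺; any⁻)
open import Data.List.Relation.Unary.All using (All)
import Data.List.Relation.Unary.All as All
import Data.List.Relation.Unary.All.Properties as All
open import Data.List.Relation.Unary.AllPairs using ([]; _∷_)
import Data.List.Relation.Unary.AllPairs as AllPairs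
import Data.List.Relation.Unary.AllPairs.Properties as AllPairs
open import Data.List.Relation.Unary.Unique.Propositional using (Unique)
import Data.List.Relation.Unary.Unique.Propositional.Properties as Unique
open import Data.List.Relation.Binary.Permutation.Propositional using (_↭_; ↭-sym)
open import Data.List.Relation.Binary.Permutation.Propositional.Properties using (↭-length; filter-↭)
open import Data.List.Relation.Binary.BagAndSetEquality using (∼bag⇒↭)
open import Function using (_∘_; _⇔_; mk⇔; Equivalence)
open import Relation.Nullary using (¬_; Dec; yes; no; _×-dec_)
open import Relation.Nullary.Decidable using (toWitness)
open import Relation.Unary using (Decidable)
open import Relation.Binary.Definitions using (Tri; tri<; tri≈; tri>)
open import Relation.Binary.PropositionalEquality

T-ext : ∀ {a b} → (T a → T b) → (T b → T a) → a ≡ b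
T-ext {false} {false} _ _ = refl
T-ext {false} {true}  _ g = ⊥-elim (g tt)
T-ext {true}  {false} f _ = ⊥-elim (f tt)
T-ext {true}  {true}  _ _ = refl

boolFilter≡filter : {A : Set} (p : A → Bool) (xs : List A) →
  boolFilter p xs ≡ filter (T? ∘ p) xs
boolFilter≡filter p []       = refl
boolFilter≡filter p (x ∷ xs) with p x
... | true  = cong (x ∷_) (boolFilter≡filter p xs)
... | false = boolFilter≡filter p xs

count : {A : Set} → (A → Bool) → List A → ℕ
count p xs = length (boolFilter p xs)

count-↭ : {A : Set} (p : A → Bool) {xs ys : List A} → xs ↭ ys → count p xs ≡ count p ys
count-↭ p {xs} {ys} xs↭ys = begin
  count p xs                   ≡⟨ cong length (boolFilter≡filter p xs) ⟩
  length (filter (T? ∘ p) xs)  ≡⟨ ↭-length (filter-↭ (T? ∘ p) xs↭ys) ⟩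
  length (filter (T? ∘ p) ys)  ≡⟨ cong length (sym (boolFilter≡filter p ys)) ⟩
  count p ys                   ∎
  where open ≡-Reasoning

count-map : {A B : Set} (p : B → Bool) (g : A → B) (xs : List A) →
  count p (map g xs) ≡ count (p ∘ g) xs
count-map p g []       = refl
count-map p g (x ∷ xs) with p (g x)
... | true  = cong suc (count-map p g xs)
... | false = count-map p g xs

count-cong : {A : Set} {p q : A → Bool} (xs : List A) →
  (∀ {x} → x ∈ xs → p x ≡ q x) → count p xs ≡ count q xs
count-cong []           _   = refl
count-cong {p = p} {q} (x ∷ xs) p≡q with p x | q x | p≡q (here refl)
... | true  | true  | _ = cong suc (count-cong xs (p≡q ∘ there))
... | false | false | _ = count-cong xs (p≡q ∘ there)

unique-map : {A B : Set} {xs : List A} {g : A → B} (h : B → A) →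
  (∀ {x} → x ∈ xs → h (g x) ≡ x) → Unique xs → Unique (map g xs)
unique-map {xs = xs} h hg uniq =
  Unique.map⁻ {f = h} (subst Unique (sym (trans (sym (map-∘ xs)) (map-id-local (All.tabulate hg)))) uniq)

module _ {A : Set} {xs : List A} (uniq : Unique xs) (g h : A → A)
  (g∈ : ∀ {x} → x ∈ xs → g x ∈ xs) (h∈ : ∀ {x} → x ∈ xs → h x ∈ xs)
  (hg : ∀ {x} → x ∈ xs → h (g x) ≡ x) (gh : ∀ {x} → x ∈ xs → g (h x) ≡ x) where

  map-↭ : map g xs ↭ xs
  map-↭ = ∼bag⇒↭ (unique∧set⇒bag (unique-map h hg uniq) uniq (mk⇔ to from))
    where
    to : ∀ {z} → z ∈ map g xs → z ∈ xs
    to z∈ with x , x∈ , refl ← ∈-map⁻ g z∈ = g∈ x∈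
    from : ∀ {z} → z ∈ xs → z ∈ map g xs
    from z∈ = subst (_∈ map g xs) (gh z∈) (∈-map⁺ g (h∈ z∈))

  count-bij : (p q : A → Bool) → (∀ {x} → x ∈ xs → p (g x) ≡ q x) →
    count p xs ≡ count q xs
  count-bij p q pg≡q = begin
    count p xs          ≡⟨ count-↭ p (↭-sym map-↭) ⟩
    count p (map g xs)  ≡⟨ count-map p g xs ⟩
    count (p ∘ g) xs    ≡⟨ count-cong xs pg≡q ⟩
    count q xs          ∎
    where open ≡-Reasoning

T-not⇒¬T : ∀ {b} → T (not b) → ¬ T b
T-not⇒¬T {false} _ ()

¬T⇒T-not : ∀ {b} → ¬ T b → T (not b)
¬T⇒T-not {false} _  = tt
¬T⇒T-not {true}  ¬t = ¬t tt

¬T-not⇒T : ∀ {b} → ¬ T (not b) → T b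
¬T-not⇒T {true}  _    = tt
¬T-not⇒T {false} ¬tt = ¬tt tt

In : ℕ → ℕ → Set
In n i = 1 ≤ i × i ≤ n

∈-range⁻ : ∀ n {i} → i ∈ range n → In n i
∈-range⁻ n i∈ with _ , j<n , refl ← ∈-applyUpTo⁻ suc i∈ = s≤s z≤n , j<n

∈-range⁺ : ∀ n {i} → In n i → i ∈ range n
∈-range⁺ n {suc i} (_ , i<n) = ∈-applyUpTo⁺ suc i<n

unique-range : ∀ n → Unique (range n)
unique-range n = Unique.applyUpTo⁺₁ suc n (λ i<j _ → <⇒≢ (s≤s i<j))

-- 0-based reading of a list (0 outside it); at σ i is the letter σᵢ
nth : List ℕ → ℕ → ℕ
nth []       i       = 0
nth (x ∷ xs) zero    = x
nth (x ∷ xs) (suc i) = nth xs i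

at : List ℕ → ℕ → ℕ
at σ i = nth σ (i ∸ 1)

nth-∈ : ∀ xs {i} → i < length xs → nth xs i ∈ xs
nth-∈ (x ∷ xs) {zero}  _         = here refl
nth-∈ (x ∷ xs) {suc i} (s≤s i<l) = there (nth-∈ xs i<l)

∈⇒nth : ∀ xs {z} → z ∈ xs → ∃ λ i → i < length xs × nth xs i ≡ z
∈⇒nth (x ∷ xs) (here refl) = 0 , s≤s z≤n , refl
∈⇒nth (x ∷ xs) (there z∈) with i , i<l , refl ← ∈⇒nth xs z∈ = suc i , s≤s i<l , refl

positionOf-nth : ∀ {xs} → Unique xs → ∀ {i} → i < length xs → positionOf (nth xs i) xs ≡ suc i
positionOf-nth {x ∷ xs} _ {zero} _ with x ≡ᵇ x | ≡⇒≡ᵇ x x refl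
... | true | _ = refl
positionOf-nth {x ∷ xs} (x∉ ∷ u) {suc i} (s≤s i<l) with nth xs i ≡ᵇ x in eq
... | true  = ⊥-elim (All.lookup x∉ (nth-∈ xs i<l) (sym (≡ᵇ⇒≡ _ _ (subst T (sym eq) tt))))
... | false = cong suc (positionOf-nth u i<l)

tab : ℕ → (ℕ → ℕ) → List ℕ
tab n g = map g (range n)

length-tab : ∀ n g → length (tab n g) ≡ n
length-tab n g = trans (length-map g (range n)) (length-applyUpTo suc n)

at-tab : ∀ n g {i} → In n i → at (tab n g) i ≡ g i
at-tab n g {suc i} (_ , i<n) = go n suc i<n
  where
  go : ∀ m f {j} → j < m → nth (map g (applyUpTo f m)) j ≡ g (f j)
  go (suc m) f {zero}  _         = refl
  go (suc m) f {suc j} (s≤s j<m) = go m (f ∘ suc) j<m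

tab-cong : ∀ n {f g} → (∀ {i} → In n i → f i ≡ g i) → tab n f ≡ tab n g
tab-cong n f≡g = map-cong-local (All.tabulate (f≡g ∘ ∈-range⁻ n))

tab-at : ∀ {n} σ → length σ ≡ n → σ ≡ tab n (at σ)
tab-at σ refl = trans (applyUpTo-nth σ) (sym (map-applyUpTo suc (at σ) (length σ)))
  where
  applyUpTo-nth : ∀ xs → xs ≡ applyUpTo (nth xs) (length xs)
  applyUpTo-nth []       = refl
  applyUpTo-nth (x ∷ xs) = cong (x ∷_) (applyUpTo-nth xs)

record IsPerm (n : ℕ) (σ : List ℕ) : Set where
  field
    length≡ : length σ ≡ n
    ⊆range  : All (_∈ range n) σ
    unique  : Unique σ

words-∈⁻ : ∀ k n {σ} → σ ∈ words k n → length σ ≡ k × All (_∈ range n) σ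
words-∈⁻ zero    n (here refl) = refl , All.[]
words-∈⁻ (suc k) n σ∈
  with a , a∈ , σ∈′ ← find (∈-concatMap⁻ (λ a → map (a ∷_) (words k n)) {xs = range n} σ∈)
  with τ , τ∈ , refl ← map∷⁻ σ∈′
  with l≡ , τ⊆ ← words-∈⁻ k n τ∈ = cong suc l≡ , a∈ All.∷ τ⊆

words-∈⁺ : ∀ k n {σ} → length σ ≡ k → All (_∈ range n) σ → σ ∈ words k n
words-∈⁺ zero    n {[]}    _  _              = here refl
words-∈⁺ (suc k) n {x ∷ σ} l≡ (x∈ All.∷ σ⊆) =
  ∈-concatMap⁺ (λ a → map (a ∷_) (words k n))
    (lose x∈ (∈-map⁺ (x ∷_) (words-∈⁺ k n (suc-injective l≡) σ⊆)))

unique-words : ∀ k n → Unique (words k n)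
unique-words zero    n = All.[] ∷ []
unique-words (suc k) n = Unique.concat⁺
  (All.map⁺ (All.tabulate (λ _ → Unique.map⁺ (proj₂ ∘ ∷-injective) (unique-words k n))))
  (AllPairs.map⁺ (AllPairs.map disjoint (unique-range n)))
  where
  disjoint : ∀ {a b} → a ≢ b → ∀ {σ} → ¬ (σ ∈ map (a ∷_) (words k n) × σ ∈ map (b ∷_) (words k n))
  disjoint a≢b (σ∈a , σ∈b) with _ , _ , refl ← map∷⁻ σ∈a with _ , _ , eq ← map∷⁻ σ∈b =
    a≢b (proj₁ (∷-injective eq))

∉⇒¬any : ∀ {x xs} → All (x ≢_) xs → ¬ T (any (x ≡ᵇ_) xs)
∉⇒¬any {x} {xs} x∉ any≡ with y , y∈ , x≡ᵇy ← find (any⁻ (x ≡ᵇ_) xs any≡) =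
  All.lookup x∉ y∈ (≡ᵇ⇒≡ x y x≡ᵇy)

¬any⇒∉ : ∀ {x xs} → ¬ T (any (x ≡ᵇ_) xs) → All (x ≢_) xs
¬any⇒∉ {x} ¬any = All.tabulate λ y∈ x≡y → ¬any (any⁺ (x ≡ᵇ_) (lose y∈ (≡⇒≡ᵇ x _ x≡y)))

distinct⇒unique : ∀ xs → T (distinct xs) → Unique xs
distinct⇒unique []       _ = []
distinct⇒unique (x ∷ xs) d with x∉ , dxs ← Equivalence.to T-∧ d =
  ¬any⇒∉ (T-not⇒¬T x∉) ∷ distinct⇒unique xs dxs

unique⇒distinct : ∀ {xs} → Unique xs → T (distinct xs)
unique⇒distinct []       = tt
unique⇒distinct (x∉ ∷ u) = Equivalence.from T-∧ (¬T⇒T-not (∉⇒¬any x∉) , unique⇒distinct u)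

perms-∈⁻ : ∀ n {σ} → σ ∈ perms n → IsPerm n σ
perms-∈⁻ n {σ} σ∈
  with σ∈w , d ← ∈-filter⁻ (T? ∘ distinct) (subst (σ ∈_) (boolFilter≡filter distinct (words n n)) σ∈)
  with l≡ , σ⊆ ← words-∈⁻ n n σ∈w = record { length≡ = l≡ ; ⊆range = σ⊆ ; unique = distinct⇒unique σ d }

perms-∈⁺ : ∀ n {σ} → IsPerm n σ → σ ∈ perms n
perms-∈⁺ n P = subst (_ ∈_) (sym (boolFilter≡filter distinct (words n n)))
  (∈-filter⁺ (T? ∘ distinct) (words-∈⁺ n n (IsPerm.length≡ P) (IsPerm.⊆range P))
    (unique⇒distinct (IsPerm.unique P)))

unique-perms : ∀ n → Unique (perms n)
unique-perms n = subst Unique (sym (boolFilter≡filter distinct (words n n)))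
  (Unique.filter⁺ (T? ∘ distinct) (unique-words n n))

-- The letters of [n]
-- occurring in σ form a duplicate-free list with the same members as σ,
-- hence of length n, so no letter of [n] can be missing.
perm-⊇range : ∀ {n σ} → IsPerm n σ → ∀ {v} → In n v → v ∈ σ
perm-⊇range {n} {σ} P {v} v∈n with v ∈? σ
... | yes v∈σ = v∈σ
... | no  v∉σ = ⊥-elim (<⇒≢ (filter-notAll (_∈? σ) (range n) (lose (∈-range⁺ n v∈n) v∉σ)) same-length)
  where
  open IsPerm P
  occurring : List ℕ
  occurring = filter (_∈? σ) (range n)
  same-length : length occurring ≡ length (range n)
  same-length = begin
    length occurring  ≡⟨ ↭-length (∼bag⇒↭ (unique∧set⇒bag (Unique.filter⁺ (_∈? σ) (unique-range n)) unique
                           (mk⇔ (λ z∈ → proj₂ (∈-filter⁻ (_∈? σ) {xs = range n} z∈))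
                                (λ z∈ → ∈-filter⁺ (_∈? σ) (All.lookup ⊆range z∈) z∈)))) ⟩
    length σ          ≡⟨ length≡ ⟩
    n                 ≡⟨ sym (length-applyUpTo suc n) ⟩
    length (range n)  ∎
    where open ≡-Reasoning

-- A permutation word σ of [n] as a pair of mutually inverse functions on [n]:
-- s i = σᵢ and t v = the position of v in σ (so inverse n σ = tab n t).
module PermView {n : ℕ} {σ : List ℕ} (P : IsPerm n σ) where
  open IsPerm P

  s t : ℕ → ℕ
  s = at σ
  t v = positionOf v σ

  private
    index< : ∀ {i} → In n i → i ∸ 1 < length σ
    index< {suc i} (_ , i<n) = subst (i <_) (sym length≡) i<n

  sIn : ∀ {i} → In n i → In n (s i)
  sIn i∈n = ∈-range⁻ n (All.lookup ⊆range (nth-∈ σ (index< i∈n)))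

  ts : ∀ {i} → In n i → t (s i) ≡ i
  ts {suc i} i∈n = positionOf-nth unique (index< i∈n)

  preimage : ∀ {v} → In n v → ∃ λ i → In n i × s i ≡ v
  preimage v∈n with j , j<l , refl ← ∈⇒nth σ (perm-⊇range P v∈n) =
    suc j , (s≤s z≤n , subst (j <_) length≡ j<l) , refl

  st : ∀ {v} → In n v → s (t v) ≡ v
  st v∈n with i , i∈n , refl ← preimage v∈n = cong s (ts i∈n)

  tIn : ∀ {v} → In n v → In n (t v)
  tIn v∈n with i , i∈n , refl ← preimage v∈n = subst (In n) (sym (ts i∈n)) i∈n

  σ≡tab : σ ≡ tab n s
  σ≡tab = tab-at σ length≡

module _ (Q : ℕ → Set) (Q? : Decidable Q) where

  private
    firstUpTo : ∀ k → (∃ λ v → Q v × v ≤ k × (∀ {u} → u < v → ¬ Q u)) ⊎ (∀ {u} → u ≤ k → ¬ Q u)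
    firstUpTo zero with Q? 0
    ... | yes q0 = inj₁ (0 , q0 , z≤n , λ ())
    ... | no ¬q0 = inj₂ λ { z≤n → ¬q0 }
    firstUpTo (suc k) with firstUpTo k
    ... | inj₁ (v , qv , v≤k , min) = inj₁ (v , qv , m≤n⇒m≤1+n v≤k , min)
    ... | inj₂ none with Q? (suc k)
    ...   | yes q = inj₁ (suc k , q , ≤-refl , none ∘ s≤s⁻¹)
    ...   | no ¬q = inj₂ (λ u≤ → noneUpTo (m≤n⇒m<n∨m≡n u≤))
      where
      noneUpTo : ∀ {u} → u < suc k ⊎ u ≡ suc k → ¬ Q u
      noneUpTo (inj₁ u<) = none (s≤s⁻¹ u<)
      noneUpTo (inj₂ refl) = ¬q

  least : ∀ {k} → Q k → ∃ λ v → Q v × v ≤ k × (∀ {u} → u < v → ¬ Q u)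
  least {k} qk with firstUpTo k
  ... | inj₁ found = found
  ... | inj₂ none  = ⊥-elim (none ≤-refl qk)

  greatestBelow : ∀ B {k} → Q k → k < B → ∃ λ v → Q v × v < B × (∀ {u} → v < u → u < B → ¬ Q u)
  greatestBelow (suc B) qk k<1+B with Q? B
  ... | yes qB = B , qB , ≤-refl , λ B<u u<1+B → ⊥-elim (<⇒≱ B<u (s≤s⁻¹ u<1+B))
  ... | no ¬qB with m≤n⇒m<n∨m≡n (s≤s⁻¹ k<1+B)
  ...   | inj₂ refl = ⊥-elim (¬qB qk)
  ...   | inj₁ k<B with v , qv , v<B , max ← greatestBelow B qk k<B =
    v , qv , m<n⇒m<1+n v<B , λ v<u u<1+B → noneAbove v<u (m≤n⇒m<n∨m≡n (s≤s⁻¹ u<1+B))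
    where
    noneAbove : ∀ {u} → v < u → u < B ⊎ u ≡ B → ¬ Q u
    noneAbove v<u (inj₁ u<B) = max v<u u<B
    noneAbove _   (inj₂ refl) = ¬qB

record Triple (n : ℕ) : Set where
  constructor triple
  field
    i j k : ℕ
    1≤i   : 1 ≤ i
    k≤n   : k ≤ n
    i<j   : i < j
    j<k   : j < k

  In-between : ∀ {m} → i ≤ m → m ≤ k → In n m
  In-between i≤m m≤k = ≤-trans 1≤i i≤m , ≤-trans m≤k k≤n

  In-i : In n i
  In-i = In-between ≤-refl (<⇒≤ (<-trans i<j j<k))

  In-j : In n j
  In-j = In-between (<⇒≤ i<j) (<⇒≤ j<k)

  In-k : In n k
  In-k = In-between (<⇒≤ (<-trans i<j j<k)) ≤-refl

  Inner : ℕ → Set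
  Inner m = i < m × m < k × m ≢ j

  Inner⇒In : ∀ {m} → Inner m → In n m
  Inner⇒In (i<m , m<k , _) = In-between (<⇒≤ i<m) (<⇒≤ m<k)

open Triple using (i; j; k; In-i; In-j; In-k; Inner)

Is321 Is132 Is213 : ℕ → ℕ → ℕ → Set
Is321 a b c = c < b × b < a
Is132 a b c = a < c × c < b
Is213 a b c = b < a × a < c

Pat : ∀ {n} → (ℕ → ℕ → ℕ → Set) → (ℕ → ℕ) → Triple n → Set
Pat P g τ = P (g (i τ)) (g (j τ)) (g (k τ))

Occ : (ℕ → ℕ → ℕ → Set) → ℕ → (ℕ → ℕ) → Set
Occ P n g = Σ (Triple n) (Pat P g)

Framed321 : ∀ n → (ℕ → ℕ) → (Triple n → ℕ → Set) → Set
Framed321 n g P = Σ (Triple n) λ τ → Pat Is321 g τ × (∀ m → Inner τ m → P τ (g m))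

-- LowDD: erasing the letters larger than g i leaves g i, g j, g k adjacent,
-- i.e. a double descent of the restriction of g to the values ≤ g i; this is
-- exactly how the simsun property fails.
LowDD : ℕ → (ℕ → ℕ) → Set
LowDD n g = Framed321 n g (λ τ v → g (i τ) < v)

-- HighDD: the mirror image, a double descent surviving after erasing the
-- letters smaller than g k.
HighDD : ℕ → (ℕ → ℕ) → Set
HighDD n g = Framed321 n g (λ τ v → v < g (k τ))

ClearDD : ℕ → (ℕ → ℕ) → Set
ClearDD n g = Framed321 n g (λ τ v → v < g (k τ) ⊎ g (i τ) < v)

low⇒clear : ∀ {n g} → LowDD n g → ClearDD n g
low⇒clear (τ , pat , above) = τ , pat , λ m inner → inj₂ (above m inner)

high⇒clear : ∀ {n g} → HighDD n g → ClearDD n g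
high⇒clear (τ , pat , below) = τ , pat , λ m inner → inj₁ (below m inner)

module InversePair {n : ℕ} {s t : ℕ → ℕ}
  (sIn : ∀ {i} → In n i → In n (s i)) (tIn : ∀ {v} → In n v → In n (t v))
  (st : ∀ {v} → In n v → s (t v) ≡ v) (ts : ∀ {i} → In n i → t (s i) ≡ i) where

  position : ∀ {m v} → In n m → s m ≡ v → m ≡ t v
  position m∈ refl = sym (ts m∈)

  -- Clear 321-occurrences of the inverse give clear 321-occurrences: if the
  -- values a < b < c sit at positions t c < t b < t a, nothing between those
  -- positions (other than t b) can take a value between a and c.
  clear-inverse : ClearDD n t → ClearDD n s
  clear-inverse (τ@(triple a b c _ _ a<b b<c) , (tc<tb , tb<ta) , outside) =
    τ′ , (subst₂ _<_ (sym (st (In-i τ))) (sym (st (In-j τ))) a<b ,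
          subst₂ _<_ (sym (st (In-j τ))) (sym (st (In-k τ))) b<c) ,
    λ m inner → subst₂ (λ x y → s m < x ⊎ y < s m) (sym (st (In-i τ))) (sym (st (In-k τ))) (outside′ inner)
    where
    τ′ : Triple n
    τ′ = triple (t c) (t b) (t a) (proj₁ (tIn (In-k τ))) (proj₂ (tIn (In-i τ))) tc<tb tb<ta
    outside′ : ∀ {m} → Inner τ′ m → s m < a ⊎ c < s m
    outside′ {m} inner@(tc<m , m<ta , m≢tb) = classify (<-cmp (s m) a) (<-cmp (s m) c)
      where
      m∈ : In n m
      m∈ = Triple.Inner⇒In τ′ inner
      classify : Tri (s m < a) (s m ≡ a) (a < s m) → Tri (s m < c) (s m ≡ c) (c < s m) → s m < a ⊎ c < s m
      classify (tri< sm<a _ _) _               = inj₁ sm<a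
      classify (tri≈ _ sm≡a _) _               = ⊥-elim (<-irrefl (position m∈ sm≡a) m<ta)
      classify (tri> _ _ _)    (tri> _ _ c<sm) = inj₂ c<sm
      classify (tri> _ _ _)    (tri≈ _ sm≡c _) = ⊥-elim (<-irrefl (sym (position m∈ sm≡c)) tc<m)
      classify (tri> _ _ a<sm) (tri< sm<c _ _) with outside (s m) (a<sm , sm<c , m≢tb ∘ position m∈)
      ... | inj₁ tsm<tc = ⊥-elim (<-asym tc<m (subst (_< t c) (ts m∈) tsm<tc))
      ... | inj₂ ta<tsm = ⊥-elim (<-asym m<ta (subst (t a <_) (ts m∈) ta<tsm))

  s-injective : ∀ {a b} → In n a → In n b → s a ≡ s b → a ≡ b
  s-injective a∈ b∈ sa≡sb = trans (position a∈ sa≡sb) (ts b∈)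

  -- 132 is its own inverse: a 132 of s at positions i < j < k is a 132 of t
  -- at the values s i < s k < s j.
  occ132-inverse : Occ Is132 n s → Occ Is132 n t
  occ132-inverse (τ , (si<sk , sk<sj)) =
    triple (s (i τ)) (s (k τ)) (s (j τ)) (proj₁ (sIn (In-i τ))) (proj₂ (sIn (In-j τ))) si<sk sk<sj ,
    (subst₂ _<_ (sym (ts (In-i τ))) (sym (ts (In-j τ))) (Triple.i<j τ) ,
     subst₂ _<_ (sym (ts (In-j τ))) (sym (ts (In-k τ))) (Triple.j<k τ))

  -- For 132-avoiding s, a clear 321 at x < y < z yields a low double descent
  -- x < y < r, where r is the first position after y carrying a value
  -- below s y.
  clear⇒low : ¬ Occ Is132 n s → ClearDD n s → LowDD n s
  clear⇒low avoid (τ@(triple x y z 1≤x z≤n′ x<y y<z) , (sz<sy , sy<sx) , outside)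
    with r , (y<r , sr<sy) , r≤z , first
           ← least (λ u → y < u × s u < s y) (λ u → (y <? u) ×-dec (s u <? s y)) (y<z , sz<sy) =
    τ′ , (sr<sy , sy<sx) , above
    where
    τ′ : Triple n
    τ′ = triple x y r 1≤x (≤-trans r≤z z≤n′) x<y y<r
    above : ∀ m → Inner τ′ m → s x < s m
    above m inner@(x<m , m<r , m≢y) = bySx (<-cmp (s m) (s x))
      where
      m∈ : In n m
      m∈ = Triple.Inner⇒In τ′ inner
      m<z : m < z
      m<z = <-≤-trans m<r r≤z
      -- a value below s z would create a 132 (if m < y) or come before r (if y < m)
      ¬below-sz : s m < s z → ⊥
      ¬below-sz sm<sz with <-cmp m y
      ... | tri< m<y _ _ = avoid (triple m y z (≤-trans 1≤x (<⇒≤ x<m)) z≤n′ m<y y<z , sm<sz , sz<sy)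
      ... | tri≈ _ m≡y _ = m≢y m≡y
      ... | tri> _ _ y<m = first m<r (y<m , <-trans sm<sz sz<sy)
      -- a value between s z and s x is excluded by clearness
      bySz : Tri (s z < s m) (s z ≡ s m) (s m < s z) → s m < s x → ⊥
      bySz (tri< sz<sm _ _) sm<sx with outside m (x<m , m<z , m≢y)
      ... | inj₁ sm<sz = <-asym sz<sm sm<sz
      ... | inj₂ sx<sm = <-asym sm<sx sx<sm
      bySz (tri≈ _ sz≡sm _) _ = <-irrefl (sym (s-injective (In-k τ) m∈ sz≡sm)) m<z
      bySz (tri> _ _ sm<sz) _ = ¬below-sz sm<sz
      bySx : Tri (s m < s x) (s m ≡ s x) (s x < s m) → s x < s m
      bySx (tri< sm<sx _ _) = ⊥-elim (bySz (<-cmp (s z) (s m)) sm<sx)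
      bySx (tri≈ _ sm≡sx _) = ⊥-elim (<-irrefl (sym (s-injective m∈ (In-i τ) sm≡sx)) x<m)
      bySx (tri> _ _ sx<sm) = sx<sm

  -- A low double descent at adjacent positions j, j + 1 makes j - 1, j, j + 1
  -- a double descent of consecutive letters, which is also high.
  low-adjacent⇒high : ((τ , _) : LowDD n s) → suc (j τ) ≡ k τ → HighDD n s
  low-adjacent⇒high (triple p zero _ _ _ () _ , _) _
  low-adjacent⇒high (triple p (suc q) _ 1≤p k≤n p<q _ , (sr<sq , sq<sp) , above) refl =
    triple q (suc q) (suc (suc q)) (≤-trans 1≤p (s≤s⁻¹ p<q)) k≤n ≤-refl ≤-refl ,
    (sr<sq , sq<sq-1 (m≤n⇒m<n∨m≡n (s≤s⁻¹ p<q))) ,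
    λ m (q<m , m<q+2 , m≢q+1) → ⊥-elim (m≢q+1 (≤-antisym (s≤s⁻¹ m<q+2) q<m))
    where
    sq<sq-1 : p < q ⊎ p ≡ q → s (suc q) < s q
    sq<sq-1 (inj₁ p<q-1) = <-trans sq<sp (above q (p<q-1 , m≤n⇒m≤1+n ≤-refl , 1+n≢n ∘ sym))
    sq<sq-1 (inj₂ refl)  = sq<sp

  -- A low double descent p < q < r of a 132-avoiding s with q + 1 < r gives a
  -- high double descent of t on the values a < s q < s p, where a is the
  -- largest value below s q sitting to the right of p (s r is a candidate).
  low-spread⇒high-inverse : ¬ Occ Is132 n s → ((τ , _) : LowDD n s) → suc (j τ) < k τ → HighDD n t
  low-spread⇒high-inverse avoid (τ@(triple p q r _ _ p<q q<r) , (sr<sq , sq<sp) , above) q+1<r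
    with a , (1≤a , p<ta) , a<sq , last
           ← greatestBelow (λ u → 1 ≤ u × p < t u) (λ u → (1 ≤? u) ×-dec (p <? t u)) (s q)
               (proj₁ (sIn (In-k τ)) , subst (p <_) (sym (ts (In-k τ))) (<-trans p<q q<r)) sr<sq =
    τ′ , (subst₂ _<_ (sym (ts (In-i τ))) (sym (ts (In-j τ))) p<q , subst (_< t a) (sym (ts (In-j τ))) q<ta) ,
    λ u inner → subst (t u <_) (sym (ts (In-i τ))) (left-of-p inner)
    where
    τ′ : Triple n
    τ′ = triple a (s q) (s p) 1≤a (proj₂ (sIn (In-i τ))) a<sq sq<sp
    -- t a cannot be q, nor lie inside the low double descent (its value is too small)
    q<ta : q < t a
    q<ta with <-cmp (t a) q
    ... | tri> _ _ q<ta = q<ta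
    ... | tri≈ _ ta≡q _ = ⊥-elim (<-irrefl (trans (sym (st (In-i τ′))) (cong s ta≡q)) a<sq)
    ... | tri< ta<q _ _ = ⊥-elim (<-asym (<-trans a<sq sq<sp)
            (subst (s p <_) (st (In-i τ′)) (above (t a) (p<ta , <-trans ta<q q<r , <⇒≢ ta<q))))
    -- a value u ∈ (s q, s p) right of p would lie inside the low double descent
    -- (too small), at r (too large), or right of r, where q, q + 1, t u is a 132
    ¬right-of-p : ∀ {u} → Inner τ′ u → s q < u → p < t u → ⊥
    ¬right-of-p {u} inner@(_ , u<sp , u≢sq) sq<u p<tu = byPosition (<-cmp (t u) r)
      where
      u∈ : In n u
      u∈ = Triple.Inner⇒In τ′ inner
      byPosition : Tri (t u < r) (t u ≡ r) (r < t u) → ⊥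
      byPosition (tri< tu<r _ _) = <-asym u<sp (subst (s p <_) (st u∈)
        (above (t u) (p<tu , tu<r , λ tu≡q → u≢sq (trans (sym (st u∈)) (cong s tu≡q)))))
      byPosition (tri≈ _ tu≡r _) = <-asym sq<u (subst (_< s q) (trans (cong s (sym tu≡r)) (st u∈)) sr<sq)
      byPosition (tri> _ _ r<tu) = avoid
        (triple q (suc q) (t u) (proj₁ (In-j τ)) (proj₂ (tIn u∈)) ≤-refl (<-trans q+1<r r<tu) ,
        subst (s q <_) (sym (st u∈)) sq<u ,
        subst (_< s (suc q)) (sym (st u∈)) (<-trans u<sp (above (suc q) (≤-trans p<q (n≤1+n q) , q+1<r , 1+n≢n))))
    left-of-p : ∀ {u} → Inner τ′ u → t u < p
    left-of-p {u} inner@(a<u , u<sp , u≢sq) with <-cmp (t u) p | <-cmp u (s q)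
    ... | tri< tu<p _ _ | _            = tu<p
    ... | tri≈ _ tu≡p _ | _            =
      ⊥-elim (<-irrefl (trans (sym (st (Triple.Inner⇒In τ′ inner))) (cong s tu≡p)) u<sp)
    ... | tri> _ _ p<tu | tri< u<sq _ _ = ⊥-elim (last a<u u<sq (≤-trans 1≤a (<⇒≤ a<u) , p<tu))
    ... | tri> _ _ _    | tri≈ _ u≡sq _ = ⊥-elim (u≢sq u≡sq)
    ... | tri> _ _ p<tu | tri> _ _ sq<u = ⊥-elim (¬right-of-p inner sq<u p<tu)

  low⇒high : ¬ Occ Is132 n s → LowDD n s → HighDD n t ⊎ HighDD n s
  low⇒high avoid low@(τ , _) with m≤n⇒m<n∨m≡n (Triple.j<k τ)
  ... | inj₁ spread   = inj₁ (low-spread⇒high-inverse avoid low spread)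
  ... | inj₂ adjacent = inj₂ (low-adjacent⇒high low adjacent)

  no-low⇔no-high : ¬ Occ Is132 n s → (¬ LowDD n s × ¬ LowDD n t) ⇔ (¬ HighDD n t × ¬ HighDD n s)
  no-low⇔no-high avoid = mk⇔
    (λ (¬low-s , _) → ¬low-s ∘ clear⇒low avoid ∘ clear-inverse ∘ high⇒clear ,
                      ¬low-s ∘ clear⇒low avoid ∘ high⇒clear)
    (λ (¬high-t , ¬high-s) → let ¬low-s = [ ¬high-t , ¬high-s ]′ ∘ low⇒high avoid in
                             ¬low-s , ¬low-s ∘ clear⇒low avoid ∘ clear-inverse ∘ low⇒clear)

-- Reverse-complement on [n]: rv i = n + 1 - i, and rc g = rv ∘ g ∘ rv is the
-- permutation whose one-line word is the reversed, complemented word of g.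
-- It turns low double descents into high ones and 132 into 213.
module ReverseComplement (n : ℕ) where

  rv : ℕ → ℕ
  rv i = suc n ∸ i

  rc : (ℕ → ℕ) → ℕ → ℕ
  rc g = rv ∘ g ∘ rv

  rvIn : ∀ {i} → In n i → In n (rv i)
  rvIn {suc i} (_ , i≤n) = m<n⇒0<n∸m (s≤s i≤n) , m∸n≤m n i

  rv-invol : ∀ {i} → In n i → rv (rv i) ≡ i
  rv-invol (_ , i≤n) = m∸[m∸n]≡n (m≤n⇒m≤1+n i≤n)

  rv-anti : ∀ {i j} → In n j → i < j → rv j < rv i
  rv-anti (_ , j≤n) i<j = ∸-monoʳ-< i<j (m≤n⇒m≤1+n j≤n)

  rv-reflect : ∀ {i j} → In n i → In n j → rv i < rv j → j < i
  rv-reflect i∈ j∈ rvi<rvj = subst₂ _<_ (rv-invol j∈) (rv-invol i∈) (rv-anti (rvIn j∈) rvi<rvj)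

  reverse : Triple n → Triple n
  reverse τ@(triple i j k _ _ i<j j<k) =
    triple (rv k) (rv j) (rv i) (proj₁ (rvIn (In-k τ))) (proj₂ (rvIn (In-i τ)))
      (rv-anti (In-k τ) j<k) (rv-anti (In-j τ) i<j)

  reverse-inner : ∀ τ {m} → Inner (reverse τ) m → Inner τ (rv m)
  reverse-inner τ {m} (rvk<m , m<rvi , m≢rvj) =
    subst (_< rv m) (rv-invol (In-i τ)) (rv-anti (rvIn (In-i τ)) m<rvi) ,
    subst (rv m <_) (rv-invol (In-k τ)) (rv-anti m∈ rvk<m) ,
    λ rvm≡j → m≢rvj (trans (sym (rv-invol m∈)) (cong rv rvm≡j))
    where
    m∈ : In n m
    m∈ = Triple.Inner⇒In (reverse τ) (rvk<m , m<rvi , m≢rvj)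

  module _ {g : ℕ → ℕ} (gIn : ∀ {i} → In n i → In n (g i)) where

    rc-∘ : ∀ {f} → (∀ {v} → In n v → f (g v) ≡ v) → ∀ {v} → In n v → rc f (rc g v) ≡ v
    rc-∘ {f} fg {v} v∈ = begin
      rv (f (rv (rv (g (rv v)))))  ≡⟨ cong (rv ∘ f) (rv-invol (gIn (rvIn v∈))) ⟩
      rv (f (g (rv v)))            ≡⟨ cong rv (fg (rvIn v∈)) ⟩
      rv (rv v)                    ≡⟨ rv-invol v∈ ⟩
      v                            ∎
      where open ≡-Reasoning

    rc-rc : ∀ {v} → In n v → rc (rc g) v ≡ g v
    rc-rc v∈ = trans (rv-invol (gIn (rvIn (rvIn v∈)))) (cong g (rv-invol v∈))

    rcIn : ∀ {i} → In n i → In n (rc g i)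
    rcIn = rvIn ∘ gIn ∘ rvIn

    rc-rv : ∀ {i} → In n i → rc g (rv i) ≡ rv (g i)
    rc-rv i∈ = cong (rv ∘ g) (rv-invol i∈)

    rc-anti : ∀ {i j} → In n i → In n j → g i < g j → rc g (rv j) < rc g (rv i)
    rc-anti i∈ j∈ gi<gj = subst₂ _<_ (sym (rc-rv j∈)) (sym (rc-rv i∈)) (rv-anti (gIn j∈) gi<gj)

    rc-reflect : ∀ {i j} → In n i → In n j → rc g i < rc g j → g (rv j) < g (rv i)
    rc-reflect i∈ j∈ = rv-reflect (gIn (rvIn i∈)) (gIn (rvIn j∈))

    high⇒low-rc : HighDD n g → LowDD n (rc g)
    high⇒low-rc (τ , (gk<gj , gj<gi) , below) =
      reverse τ , (rc-anti (In-j τ) (In-i τ) gj<gi , rc-anti (In-k τ) (In-j τ) gk<gj) ,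
      λ m inner → let m∈ = Triple.Inner⇒In (reverse τ) inner in
        subst (λ x → rc g (rv (k τ)) < rc g x) (rv-invol m∈)
          (rc-anti (rvIn m∈) (In-k τ) (below (rv m) (reverse-inner τ inner)))

    low-rc⇒high : LowDD n (rc g) → HighDD n g
    low-rc⇒high (τ , (rck<rcj , rcj<rci) , above) =
      reverse τ , (rc-reflect (In-j τ) (In-i τ) rcj<rci , rc-reflect (In-k τ) (In-j τ) rck<rcj) ,
      λ m inner → let m∈ = Triple.Inner⇒In (reverse τ) inner in
        subst (λ x → g x < g (rv (i τ))) (rv-invol m∈)
          (rc-reflect (In-i τ) (rvIn m∈) (above (rv m) (reverse-inner τ inner)))

    occ132⇒occ213-rc : Occ Is132 n g → Occ Is213 n (rc g)
    occ132⇒occ213-rc (τ , (gi<gk , gk<gj)) =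
      reverse τ , (rc-anti (In-k τ) (In-j τ) gk<gj , rc-anti (In-i τ) (In-k τ) gi<gk)

    occ213-rc⇒occ132 : Occ Is213 n (rc g) → Occ Is132 n g
    occ213-rc⇒occ132 (τ , (rcj<rci , rci<rck)) =
      reverse τ , (rc-reflect (In-i τ) (In-k τ) rci<rck , rc-reflect (In-j τ) (In-i τ) rcj<rci)

subseqs1⁻ : ∀ τ {w} → w ∈ subseqs 1 τ → ∃ λ c → c < length τ × w ≡ nth τ c ∷ []
subseqs1⁻ (x ∷ τ) w∈ with ∈-++⁻ (map (x ∷_) (subseqs 0 τ)) w∈
... | inj₁ (here refl) = 0 , s≤s z≤n , refl
... | inj₂ w∈′ with c , c< , refl ← subseqs1⁻ τ w∈′ = suc c , s≤s c< , refl

subseqs2⁻ : ∀ τ {w} → w ∈ subseqs 2 τ → ∃₂ λ b c → b < c × c < length τ × w ≡ nth τ b ∷ nth τ c ∷ []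
subseqs2⁻ (x ∷ τ) w∈ with ∈-++⁻ (map (x ∷_) (subseqs 1 τ)) w∈
... | inj₁ w∈′ with _ , w′∈ , refl ← map∷⁻ w∈′ with c , c< , refl ← subseqs1⁻ τ w′∈ =
  0 , suc c , s≤s z≤n , s≤s c< , refl
... | inj₂ w∈′ with b , c , b<c , c< , refl ← subseqs2⁻ τ w∈′ = suc b , suc c , s≤s b<c , s≤s c< , refl

subseqs3⁻ : ∀ τ {w} → w ∈ subseqs 3 τ →
  ∃₂ λ a b → ∃ λ c → a < b × b < c × c < length τ × w ≡ nth τ a ∷ nth τ b ∷ nth τ c ∷ []
subseqs3⁻ (x ∷ τ) w∈ with ∈-++⁻ (map (x ∷_) (subseqs 2 τ)) w∈
... | inj₁ w∈′ with _ , w′∈ , refl ← map∷⁻ w∈′ with b , c , b<c , c< , refl ← subseqs2⁻ τ w′∈ =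
  0 , suc b , suc c , s≤s z≤n , s≤s b<c , s≤s c< , refl
... | inj₂ w∈′ with a , b , c , a<b , b<c , c< , refl ← subseqs3⁻ τ w∈′ =
  suc a , suc b , suc c , s≤s a<b , s≤s b<c , s≤s c< , refl

subseqs1⁺ : ∀ τ {c} → c < length τ → (nth τ c ∷ []) ∈ subseqs 1 τ
subseqs1⁺ (x ∷ τ) {zero}  _        = ∈-++⁺ˡ {ys = subseqs 1 τ} (here refl)
subseqs1⁺ (x ∷ τ) {suc c} (s≤s c<) = ∈-++⁺ʳ (map (x ∷_) (subseqs 0 τ)) (subseqs1⁺ τ c<)

subseqs2⁺ : ∀ τ {b c} → b < c → c < length τ → (nth τ b ∷ nth τ c ∷ []) ∈ subseqs 2 τ
subseqs2⁺ (x ∷ τ) {zero}  {suc c} _         (s≤s c<) = ∈-++⁺ˡ (∈-map⁺ (x ∷_) (subseqs1⁺ τ c<))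
subseqs2⁺ (x ∷ τ) {suc b} {suc c} (s≤s b<c) (s≤s c<) =
  ∈-++⁺ʳ (map (x ∷_) (subseqs 1 τ)) (subseqs2⁺ τ b<c c<)

subseqs3⁺ : ∀ τ {a b c} → a < b → b < c → c < length τ →
  (nth τ a ∷ nth τ b ∷ nth τ c ∷ []) ∈ subseqs 3 τ
subseqs3⁺ (x ∷ τ) {zero}  {suc b} {suc c} _         (s≤s b<c) (s≤s c<) =
  ∈-++⁺ˡ (∈-map⁺ (x ∷_) (subseqs2⁺ τ b<c c<))
subseqs3⁺ (x ∷ τ) {suc a} {suc b} {suc c} (s≤s a<b) (s≤s b<c) (s≤s c<) =
  ∈-++⁺ʳ (map (x ∷_) (subseqs 2 τ)) (subseqs3⁺ τ a<b b<c c<)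

orderIso-pair : ∀ {a ω} → T (orderIso a ω) → ∀ {x u y v} →
  (x , u) ∈ zip a ω → (y , v) ∈ zip a ω → (x <ᵇ y) ≡ (u <ᵇ v)
orderIso-pair iso xu∈ yv∈ =
  toWitness (All.lookup (All.all⁺ _ _ (All.lookup (All.all⁺ _ _ (proj₂ (Equivalence.to T-∧ iso))) xu∈)) yv∈)

<ᵇ-true⁻ : ∀ {x y} → (x <ᵇ y) ≡ true → x < y
<ᵇ-true⁻ {x} {y} e = <ᵇ⇒< x y (subst T (sym e) tt)

<ᵇ-true : ∀ {x y} → x < y → (x <ᵇ y) ≡ true
<ᵇ-true x<y = Equivalence.to T-≡ (<⇒<ᵇ x<y)

<ᵇ-false : ∀ {x y} → y ≤ x → (x <ᵇ y) ≡ false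
<ᵇ-false {x} {y} y≤x = Equivalence.to T-not-≡ (¬T⇒T-not (λ x<ᵇy → <⇒≱ (<ᵇ⇒< x y x<ᵇy) y≤x))

iso132 : ∀ {a b c} → T (orderIso (a ∷ b ∷ c ∷ []) p132) ⇔ Is132 a b c
iso132 {a} {b} {c} = mk⇔
  (λ iso → <ᵇ-true⁻ (orderIso-pair {a ∷ b ∷ c ∷ []} {p132} iso (here refl) (there (there (here refl)))) ,
           <ᵇ-true⁻ (orderIso-pair {a ∷ b ∷ c ∷ []} {p132} iso (there (there (here refl))) (there (here refl))))
  (λ (a<c , c<b) → lemma a<c c<b)
  where
  lemma : a < c → c < b → T (orderIso (a ∷ b ∷ c ∷ []) p132)
  lemma a<c c<b
    rewrite <ᵇ-false (≤-refl {a}) | <ᵇ-false (≤-refl {b}) | <ᵇ-false (≤-refl {c})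
          | <ᵇ-true (<-trans a<c c<b) | <ᵇ-true a<c | <ᵇ-true c<b
          | <ᵇ-false (<⇒≤ (<-trans a<c c<b)) | <ᵇ-false (<⇒≤ a<c) | <ᵇ-false (<⇒≤ c<b) = tt

iso213 : ∀ {a b c} → T (orderIso (a ∷ b ∷ c ∷ []) p213) ⇔ Is213 a b c
iso213 {a} {b} {c} = mk⇔
  (λ iso → <ᵇ-true⁻ (orderIso-pair {a ∷ b ∷ c ∷ []} {p213} iso (there (here refl)) (here refl)) ,
           <ᵇ-true⁻ (orderIso-pair {a ∷ b ∷ c ∷ []} {p213} iso (here refl) (there (there (here refl)))))
  (λ (b<a , a<c) → lemma b<a a<c)
  where
  lemma : b < a → a < c → T (orderIso (a ∷ b ∷ c ∷ []) p213)
  lemma b<a a<c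
    rewrite <ᵇ-false (≤-refl {a}) | <ᵇ-false (≤-refl {b}) | <ᵇ-false (≤-refl {c})
          | <ᵇ-true (<-trans b<a a<c) | <ᵇ-true b<a | <ᵇ-true a<c
          | <ᵇ-false (<⇒≤ (<-trans b<a a<c)) | <ᵇ-false (<⇒≤ b<a) | <ᵇ-false (<⇒≤ a<c) = tt

module _ {x y z : ℕ} {P : ℕ → ℕ → ℕ → Set}
  (iso⇔ : ∀ {a b c} → T (orderIso (a ∷ b ∷ c ∷ []) (x ∷ y ∷ z ∷ [])) ⇔ P a b c) where

  contains⇔occ : ∀ {n σ} → length σ ≡ n → T (contains (x ∷ y ∷ z ∷ []) σ) ⇔ Occ P n (at σ)
  contains⇔occ {σ = σ} refl = mk⇔ to from
    where
    to : T (contains (x ∷ y ∷ z ∷ []) σ) → Occ P (length σ) (at σ)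
    to cont with w , w∈ , iso ← find (any⁻ _ (subseqs 3 σ) cont)
            with a , b , c , a<b , b<c , c< , refl ← subseqs3⁻ σ w∈ =
      triple (suc a) (suc b) (suc c) (s≤s z≤n) c< (s≤s a<b) (s≤s b<c) , Equivalence.to iso⇔ iso
    from : Occ P (length σ) (at σ) → T (contains (x ∷ y ∷ z ∷ []) σ)
    from (triple (suc a) (suc b) (suc c) _ c< (s≤s a<b) (s≤s b<c) , pat) =
      any⁺ _ (lose (subseqs3⁺ σ a<b b<c c<) (Equivalence.from iso⇔ pat))

restrict-keep : ∀ {k x} τ → x ≤ k → restrict k (x ∷ τ) ≡ x ∷ restrict k τ
restrict-keep {k} {x} τ x≤k with x ≤ᵇ k | ≤⇒≤ᵇ x≤k
... | true | _ = refl

restrict-drop : ∀ {k x} τ → k < x → restrict k (x ∷ τ) ≡ restrict k τ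
restrict-drop {k} {x} τ k<x with x ≤ᵇ k in eq
... | false = refl
... | true  = ⊥-elim (<⇒≱ k<x (≤ᵇ⇒≤ x k (subst T (sym eq) tt)))

restrict-head⁻ : ∀ k τ {y rest} → restrict k τ ≡ y ∷ rest →
  ∃ λ q → q < length τ × nth τ q ≡ y × y ≤ k × (∀ m → m < q → k < nth τ m)
restrict-head⁻ k (x ∷ τ) eq with x ≤? k
... | yes x≤k with refl ← trans (sym (restrict-keep τ x≤k)) eq = 0 , s≤s z≤n , refl , x≤k , λ _ ()
... | no  x≰k with q , q< , refl , y≤k , before ← restrict-head⁻ k τ (trans (sym (restrict-drop τ (≰⇒> x≰k))) eq) =
  suc q , s≤s q< , refl , y≤k , λ { zero _ → ≰⇒> x≰k ; (suc m) (s≤s m<q) → before m m<q }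

restrict-head⁺ : ∀ k τ {q} → q < length τ → nth τ q ≤ k → (∀ m → m < q → k < nth τ m) →
  ∃ λ rest → restrict k τ ≡ nth τ q ∷ rest
restrict-head⁺ k (x ∷ τ) {zero}  _        x≤k _      = restrict k τ , restrict-keep τ x≤k
restrict-head⁺ k (x ∷ τ) {suc q} (s≤s q<) y≤k before
  with rest , eq ← restrict-head⁺ k τ q< y≤k (λ m m<q → before (suc m) (s≤s m<q)) =
  rest , trans (restrict-drop τ (before 0 (s≤s z≤n))) eq

restrict-two⁻ : ∀ k τ {y z rest} → restrict k τ ≡ y ∷ z ∷ rest →
  ∃₂ λ q r → q < r × r < length τ × nth τ q ≡ y × nth τ r ≡ z × (∀ m → m < r → m ≢ q → k < nth τ m)
restrict-two⁻ k (x ∷ τ) eq with x ≤? k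
... | yes x≤k with refl , eq′ ← ∷-injective (trans (sym (restrict-keep τ x≤k)) eq)
              with r , r< , refl , _ , before ← restrict-head⁻ k τ eq′ =
  0 , suc r , s≤s z≤n , s≤s r< , refl , refl ,
  λ { zero _ 0≢0 → ⊥-elim (0≢0 refl) ; (suc m) (s≤s m<r) _ → before m m<r }
... | no x≰k
  with q , r , q<r , r< , refl , refl , before ← restrict-two⁻ k τ (trans (sym (restrict-drop τ (≰⇒> x≰k))) eq) =
  suc q , suc r , s≤s q<r , s≤s r< , refl , refl ,
  λ { zero _ _ → ≰⇒> x≰k ; (suc m) (s≤s m<r) m≢q → before m m<r (m≢q ∘ cong suc) }

restrict-two⁺ : ∀ k τ {q r} → q < r → r < length τ → nth τ q ≤ k → nth τ r ≤ k →
  (∀ m → m < r → m ≢ q → k < nth τ m) → ∃ λ rest → restrict k τ ≡ nth τ q ∷ nth τ r ∷ rest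
restrict-two⁺ k (x ∷ τ) {zero} {suc r} _ (s≤s r<) x≤k z≤k before
  with rest , eq ← restrict-head⁺ k τ r< z≤k (λ m m<r → before (suc m) (s≤s m<r) λ ()) =
  rest , trans (restrict-keep τ x≤k) (cong (x ∷_) eq)
restrict-two⁺ k (x ∷ τ) {suc q} {suc r} (s≤s q<r) (s≤s r<) y≤k z≤k before
  with rest , eq ← restrict-two⁺ k τ q<r r< y≤k z≤k
                     (λ m m<r m≢q → before (suc m) (s≤s m<r) (m≢q ∘ suc-injective)) =
  rest , trans (restrict-drop τ (before 0 (s≤s z≤n) λ ())) eq

RestrictedDD : ℕ → List ℕ → Set
RestrictedDD k τ = ∃₂ λ p q → ∃ λ r → p < q × q < r × r < length τ ×
  nth τ r < nth τ q × nth τ q < nth τ p × nth τ p ≤ k × (∀ m → p < m → m < r → m ≢ q → k < nth τ m)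

restrictedDD-shift : ∀ {k} x τ → RestrictedDD k τ → RestrictedDD k (x ∷ τ)
restrictedDD-shift x τ (p , q , r , p<q , q<r , r< , rq , qp , p≤k , between) =
  suc p , suc q , suc r , s≤s p<q , s≤s q<r , s≤s r< , rq , qp , p≤k ,
  λ { (suc m) (s≤s p<m) (s≤s m<r) m≢q → between m p<m m<r (m≢q ∘ cong suc) }

hasDD-cons : ∀ x w → T (hasDoubleDescent w) → T (hasDoubleDescent (x ∷ w))
hasDD-cons x (y ∷ z ∷ rest) dd = Equivalence.from T-∨ (inj₂ dd)

-- restrict k τ has a double descent iff RestrictedDD k τ holds: a double
-- descent of the kept letters either starts at the first kept letter, or
-- lies in the part kept from the tail
hasDD⇒restrictedDD : ∀ k τ → T (hasDoubleDescent (restrict k τ)) → RestrictedDD k τ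
hasDD⇒restrictedDD k (x ∷ τ) dd with x ≤? k
... | no x≰k =
  restrictedDD-shift x τ (hasDD⇒restrictedDD k τ (subst (T ∘ hasDoubleDescent) (restrict-drop τ (≰⇒> x≰k)) dd))
... | yes x≤k with restrict k τ in eq | subst (T ∘ hasDoubleDescent) (restrict-keep τ x≤k) dd
...   | y ∷ z ∷ rest | dd′ with Equivalence.to T-∨ dd′
...     | inj₂ dd″ = restrictedDD-shift x τ (hasDD⇒restrictedDD k τ (subst (T ∘ hasDoubleDescent) (sym eq) dd″))
...     | inj₁ desc with q , r , q<r , r< , refl , refl , between ← restrict-two⁻ k τ eq
                    with y<x , z<y ← Equivalence.to T-∧ desc =
  0 , suc q , suc r , s≤s z≤n , s≤s q<r , s≤s r< , <ᵇ⇒< _ _ z<y , <ᵇ⇒< _ _ y<x , x≤k ,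
  λ { (suc m) _ (s≤s m<r) m≢q → between m m<r (m≢q ∘ cong suc) }

restrictedDD⇒hasDD : ∀ k τ → RestrictedDD k τ → T (hasDoubleDescent (restrict k τ))
restrictedDD⇒hasDD k (x ∷ τ) (zero , suc q , suc r , _ , s≤s q<r , s≤s r< , rq , qp , x≤k , between)
  with rest , eq ← restrict-two⁺ k τ q<r r< (≤-trans (<⇒≤ qp) x≤k) (≤-trans (<⇒≤ (<-trans rq qp)) x≤k)
                     (λ m m<r m≢q → between (suc m) (s≤s z≤n) (s≤s m<r) (m≢q ∘ suc-injective))
  rewrite restrict-keep τ x≤k | eq = Equivalence.from T-∨ (inj₁ (Equivalence.from T-∧ (<⇒<ᵇ qp , <⇒<ᵇ rq)))
restrictedDD⇒hasDD k (x ∷ τ) (suc p , suc q , suc r , s≤s p<q , s≤s q<r , s≤s r< , rq , qp , p≤k , between) =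
  keepOrDrop (x ≤? k)
  where
  inTail : T (hasDoubleDescent (restrict k τ))
  inTail = restrictedDD⇒hasDD k τ (p , q , r , p<q , q<r , r< , rq , qp , p≤k ,
             λ m p<m m<r m≢q → between (suc m) (s≤s p<m) (s≤s m<r) (m≢q ∘ suc-injective))
  keepOrDrop : Dec (x ≤ k) → T (hasDoubleDescent (restrict k (x ∷ τ)))
  keepOrDrop (yes x≤k) = subst (T ∘ hasDoubleDescent) (sym (restrict-keep τ x≤k)) (hasDD-cons x (restrict k τ) inTail)
  keepOrDrop (no x≰k)  = subst (T ∘ hasDoubleDescent) (sym (restrict-drop τ (≰⇒> x≰k))) inTail

-- A word fails to be simsun exactly when its letter function has a low double
-- descent (take k = τ_p, the largest letter of the double descent).
simsun-fails⇔low : ∀ {n τ} → length τ ≡ n → All (_∈ range n) τ → (¬ T (simsun n τ)) ⇔ LowDD n (at τ)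
simsun-fails⇔low {τ = τ} refl τ⊆ = mk⇔ to from
  where
  noDD : ℕ → Bool
  noDD k = not (hasDoubleDescent (restrict k τ))
  to : ¬ T (simsun (length τ) τ) → LowDD (length τ) (at τ)
  to ¬sim with k , _ , ¬noDD ← find (All.¬All⇒Any¬ (T? ∘ noDD) (0 ∷ range (length τ)) (¬sim ∘ All.all⁻ noDD))
          with p , q , r , p<q , q<r , r< , rq , qp , p≤k , between ← hasDD⇒restrictedDD k τ (¬T-not⇒T ¬noDD) =
    triple (suc p) (suc q) (suc r) (s≤s z≤n) r< (s≤s p<q) (s≤s q<r) , (rq , qp) ,
    λ { (suc m) (s≤s p<m , s≤s m<r , m≢q) → ≤-<-trans p≤k (between m p<m m<r (m≢q ∘ cong suc)) }
  from : LowDD (length τ) (at τ) → ¬ T (simsun (length τ) τ)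
  from (triple (suc p) (suc q) (suc r) _ r< (s≤s p<q) (s≤s q<r) , (rq , qp) , above) sim =
    T-not⇒¬T (All.lookup (All.all⁺ noDD _ sim) (there top∈))
      (restrictedDD⇒hasDD top τ (p , q , r , p<q , q<r , r< , rq , qp , ≤-refl ,
         λ m p<m m<r m≢q → above (suc m) (s≤s p<m , s≤s m<r , m≢q ∘ suc-injective)))
    where
    top : ℕ
    top = nth τ p
    top∈ : top ∈ range (length τ)
    top∈ = All.lookup τ⊆ (nth-∈ τ (<-trans p<q (<-trans q<r r<)))

module _ {n : ℕ} {f g : ℕ → ℕ} (f≗g : ∀ {i} → In n i → f i ≡ g i) where

  occ-cong : ∀ {P} → Occ P n f → Occ P n g
  occ-cong {P} (τ , pat) =
    τ , subst₂ (λ a b → P a b (g (k τ))) (f≗g (In-i τ)) (f≗g (In-j τ))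
          (subst (P (f (i τ)) (f (j τ))) (f≗g (In-k τ)) pat)

  low-cong : LowDD n f → LowDD n g
  low-cong (τ , (fk<fj , fj<fi) , above) =
    τ , (subst₂ _<_ (f≗g (In-k τ)) (f≗g (In-j τ)) fk<fj , subst₂ _<_ (f≗g (In-j τ)) (f≗g (In-i τ)) fj<fi) ,
    λ m inner → subst₂ _<_ (f≗g (In-i τ)) (f≗g (Triple.Inner⇒In τ inner)) (above m inner)

tab-isPerm : ∀ {n g h} → (∀ {i} → In n i → In n (g i)) → (∀ {i} → In n i → h (g i) ≡ i) → IsPerm n (tab n g)
tab-isPerm {n} {g} {h} gIn hg = record
  { length≡ = length-tab n g
  ; ⊆range  = All.map⁺ (All.tabulate (∈-range⁺ n ∘ gIn ∘ ∈-range⁻ n))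
  ; unique  = unique-map h (hg ∘ ∈-range⁻ n) (unique-range n)
  }

T⇔¬ : ∀ {b} {A : Set} → (¬ T b) ⇔ A → T b ⇔ (¬ A)
T⇔¬ {b} ¬b⇔A = mk⇔ (λ tb a → Equivalence.from ¬b⇔A a tb) byCases
  where
  byCases : ¬ _ → T b
  byCases ¬a with T? b
  ... | yes tb = tb
  ... | no ¬tb = ⊥-elim (¬a (Equivalence.to ¬b⇔A ¬tb))

module _ {n σ} (P : IsPerm n σ) where
  open PermView P
  open IsPerm P

  inverse-isPerm : IsPerm n (inverse n σ)
  inverse-isPerm = tab-isPerm {h = s} tIn st

  isDRS⇔ : ∀ {x y z Pω} → (∀ {a b c} → T (orderIso (a ∷ b ∷ c ∷ []) (x ∷ y ∷ z ∷ [])) ⇔ Pω a b c) →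
    T (isDRS n (x ∷ y ∷ z ∷ []) σ) ⇔ (¬ Occ Pω n s × ¬ LowDD n s × ¬ LowDD n t)
  isDRS⇔ {x} {y} {z} {Pω} iso⇔ = mk⇔
    (λ drs → let avoid , sim , simInv = flatten drs in
      Equivalence.to T-not⇔ avoid , Equivalence.to simsun⇔ sim , Equivalence.to simsunInv⇔ simInv)
    (λ (¬occ , ¬low , ¬lowInv) →
      Equivalence.from T-∧ (Equivalence.from T-not⇔ ¬occ ,
        Equivalence.from T-∧ (Equivalence.from simsun⇔ ¬low , Equivalence.from simsunInv⇔ ¬lowInv)))
    where
    flatten : ∀ {a b c} → T (a ∧ b ∧ c) → T a × T b × T c
    flatten abc = let a , bc = Equivalence.to T-∧ abc in a , Equivalence.to T-∧ bc
    T-not⇔ : T (not (contains (x ∷ y ∷ z ∷ []) σ)) ⇔ (¬ Occ Pω n s)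
    T-not⇔ = mk⇔ (λ notC occ → T-not⇒¬T notC (Equivalence.from containsω occ))
                 (λ ¬occ → ¬T⇒T-not (¬occ ∘ Equivalence.to containsω))
      where
      containsω : T (contains (x ∷ y ∷ z ∷ []) σ) ⇔ Occ Pω n s
      containsω = contains⇔occ (λ {a b c} → iso⇔ {a} {b} {c}) {σ = σ} length≡
    simsun⇔ : T (simsun n σ) ⇔ (¬ LowDD n s)
    simsun⇔ = T⇔¬ (simsun-fails⇔low length≡ ⊆range)
    simsunInv⇔ : T (simsun n (inverse n σ)) ⇔ (¬ LowDD n t)
    simsunInv⇔ = T⇔¬ (mk⇔ (low-cong (at-tab n t) ∘ Equivalence.to fails)
                          (Equivalence.from fails ∘ low-cong (sym ∘ at-tab n t)))
      where
      fails : (¬ T (simsun n (inverse n σ))) ⇔ LowDD n (at (inverse n σ))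
      fails = simsun-fails⇔low (IsPerm.length≡ inverse-isPerm) (IsPerm.⊆range inverse-isPerm)

indexed-tab : ∀ (p : ℕ × ℕ → Bool) n g → count p (indexed (tab n g)) ≡ count (λ i → p (i , g i)) (range n)
indexed-tab p n g = begin
  count p (zip (range (length (tab n g))) (tab n g))
    ≡⟨ cong (λ l → count p (zip (range l) (tab n g))) (length-tab n g) ⟩
  count p (zip (range n) (map g (range n)))
    ≡⟨ cong (count p) (zip-graph (range n)) ⟩
  count p (map (λ i → i , g i) (range n))
    ≡⟨ count-map p (λ i → i , g i) (range n) ⟩
  count (λ i → p (i , g i)) (range n)
    ∎
  where
  open ≡-Reasoning
  zip-graph : ∀ xs → zip xs (map g xs) ≡ map (λ i → i , g i) xs
  zip-graph []       = refl
  zip-graph (x ∷ xs) = cong ((x , g x) ∷_) (zip-graph xs)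

Φ : ℕ → List ℕ → List ℕ
Φ n σ = tab n (ReverseComplement.rc n (λ v → positionOf v σ))

module Involution {n σ} (P : IsPerm n σ) where
  open PermView P
  open ReverseComplement n

  Φ-isPerm : IsPerm n (Φ n σ)
  Φ-isPerm = tab-isPerm {h = rc s} (rcIn tIn) (rc-∘ tIn {f = s} st)

  module ΦView = PermView Φ-isPerm

  sΦ : ∀ {i} → In n i → ΦView.s i ≡ rc t i
  sΦ = at-tab n (rc t)

  tΦ : ∀ {v} → In n v → ΦView.t v ≡ rc s v
  tΦ {v} v∈ = begin
    ΦView.t v                    ≡⟨ cong ΦView.t (sym (trans (sΦ (rcIn sIn v∈)) (rc-∘ sIn {f = t} ts v∈))) ⟩
    ΦView.t (ΦView.s (rc s v))   ≡⟨ ΦView.ts (rcIn sIn v∈) ⟩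
    rc s v                       ∎
    where open ≡-Reasoning

  Φ-involutive : Φ n (Φ n σ) ≡ σ
  Φ-involutive = begin
    tab n (rc ΦView.t)  ≡⟨ tab-cong n (λ i∈ → trans (cong rv (tΦ (rvIn i∈))) (rc-rc sIn i∈)) ⟩
    tab n s             ≡⟨ sym σ≡tab ⟩
    σ                   ∎
    where open ≡-Reasoning

  -- A statistic #{i | i ⋈ σᵢ} is preserved by Φ as soon as y ⋈ rv x and
  -- x ⋈ rv y agree: i ↦ t (rv i) matches the letters of σ with those of Φ(σ).
  stat-invariant : (p : ℕ × ℕ → Bool) → (∀ {x y} → In n x → In n y → p (y , rv x) ≡ p (x , rv y)) →
    count p (indexed (Φ n σ)) ≡ count p (indexed σ)
  stat-invariant p swap = begin
    count p (indexed (Φ n σ))               ≡⟨ indexed-tab p n (rc t) ⟩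
    count (λ i → p (i , rc t i)) (range n)
      ≡⟨ sym (count-bij (unique-range n) (t ∘ rv) (rv ∘ s) g∈ h∈ hg gh _ _ matched) ⟩
    count (λ i → p (i , s i)) (range n)     ≡⟨ sym (indexed-tab p n s) ⟩
    count p (indexed (tab n s))             ≡⟨ cong (count p ∘ indexed) (sym σ≡tab) ⟩
    count p (indexed σ)                     ∎
    where
    open ≡-Reasoning
    g∈ : ∀ {x} → x ∈ range n → t (rv x) ∈ range n
    g∈ = ∈-range⁺ n ∘ tIn ∘ rvIn ∘ ∈-range⁻ n
    h∈ : ∀ {x} → x ∈ range n → rv (s x) ∈ range n
    h∈ = ∈-range⁺ n ∘ rvIn ∘ sIn ∘ ∈-range⁻ n
    hg : ∀ {x} → x ∈ range n → rv (s (t (rv x))) ≡ x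
    hg x∈ = let x∈n = ∈-range⁻ n x∈ in trans (cong rv (st (rvIn x∈n))) (rv-invol x∈n)
    gh : ∀ {x} → x ∈ range n → t (rv (rv (s x))) ≡ x
    gh x∈ = let x∈n = ∈-range⁻ n x∈ in trans (cong t (rv-invol (sIn x∈n))) (ts x∈n)
    matched : ∀ {x} → x ∈ range n → p (t (rv x) , s (t (rv x))) ≡ p (x , rc t x)
    matched {x} x∈ = let x∈n = ∈-range⁻ n x∈ in
      trans (cong (λ v → p (t (rv x) , v)) (st (rvIn x∈n))) (swap x∈n (tIn (rvIn x∈n)))

  Φ-exc : exc (Φ n σ) ≡ exc σ
  Φ-exc = stat-invariant _ swap-<
    where
    swap-< : ∀ {x y} → In n x → In n y → (y <ᵇ rv x) ≡ (x <ᵇ rv y)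
    swap-< {x} {y} x∈ y∈ = T-ext
      (λ lt → <⇒<ᵇ (subst (_< rv y) (rv-invol x∈) (rv-anti (rvIn x∈) (<ᵇ⇒< y (rv x) lt))))
      (λ lt → <⇒<ᵇ (subst (_< rv x) (rv-invol y∈) (rv-anti (rvIn y∈) (<ᵇ⇒< x (rv y) lt))))

  Φ-fix : fix (Φ n σ) ≡ fix σ
  Φ-fix = stat-invariant _ swap-≡
    where
    swap-≡ : ∀ {x y} → In n x → In n y → (y ≡ᵇ rv x) ≡ (x ≡ᵇ rv y)
    swap-≡ {x} {y} x∈ y∈ = T-ext
      (λ eq → ≡⇒≡ᵇ x (rv y) (trans (sym (rv-invol x∈)) (cong rv (sym (≡ᵇ⇒≡ y (rv x) eq)))))
      (λ eq → ≡⇒≡ᵇ y (rv x) (trans (sym (rv-invol y∈)) (cong rv (sym (≡ᵇ⇒≡ x (rv y) eq)))))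

  -- Φ maps DRS_n(132) onto DRS_n(213): 132 in σ is 213 in rc (σ⁻¹), the low
  -- double descents of Φ(σ) and Φ(σ)⁻¹ are the high ones of t and s, and
  -- no-low⇔no-high converts between the two simsun conditions.
  Φ-isDRS : isDRS n p213 (Φ n σ) ≡ isDRS n p132 σ
  Φ-isDRS = T-ext
    (λ drsΦ → let ¬occ213 , ¬lowΦs , ¬lowΦt = Equivalence.to (isDRS⇔ Φ-isPerm {Pω = Is213} iso213) drsΦ
                  ¬occ132 = ¬occ213 ∘ occ-cong (sym ∘ sΦ) {P = Is213} ∘ occ132⇒occ213-rc tIn ∘ Inv.occ132-inverse
                  ¬high-t = ¬lowΦs ∘ low-cong (sym ∘ sΦ) ∘ high⇒low-rc tIn
                  ¬high-s = ¬lowΦt ∘ low-cong (sym ∘ tΦ) ∘ high⇒low-rc sIn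
              in Equivalence.from (isDRS⇔ P {Pω = Is132} iso132)
                   (¬occ132 , Equivalence.from (Inv.no-low⇔no-high ¬occ132) (¬high-t , ¬high-s)))
    (λ drs → let ¬occ132 , ¬low-s , ¬low-t = Equivalence.to (isDRS⇔ P {Pω = Is132} iso132) drs
                 ¬high-t , ¬high-s = Equivalence.to (Inv.no-low⇔no-high ¬occ132) (¬low-s , ¬low-t)
             in Equivalence.from (isDRS⇔ Φ-isPerm {Pω = Is213} iso213)
                  (¬occ132 ∘ Inv⁻¹.occ132-inverse ∘ occ213-rc⇒occ132 tIn ∘ occ-cong sΦ {P = Is213} ,
                   ¬high-t ∘ low-rc⇒high tIn ∘ low-cong sΦ ,
                   ¬high-s ∘ low-rc⇒high sIn ∘ low-cong tΦ))
    where
    module Inv   = InversePair sIn tIn st ts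
    module Inv⁻¹ = InversePair tIn sIn ts st

corollary4p3 : (n : ℕ) → 1 ≤ n → (i j : ℕ) →
    countDRS n p132 i j ≡ countDRS n p213 i j
corollary4p3 n _ nExc nFix =
  sym (count-bij (unique-perms n) (Φ n) (Φ n) Φ∈ Φ∈ ΦΦ≡id ΦΦ≡id (selected p213) (selected p132) Φ-selected)
  where
  selected : List ℕ → List ℕ → Bool
  selected ω σ = isDRS n ω σ ∧ (exc σ ≡ᵇ nExc) ∧ (fix σ ≡ᵇ nFix)
  Φ∈ : ∀ {σ} → σ ∈ perms n → Φ n σ ∈ perms n
  Φ∈ σ∈ = perms-∈⁺ n (Involution.Φ-isPerm (perms-∈⁻ n σ∈))
  ΦΦ≡id : ∀ {σ} → σ ∈ perms n → Φ n (Φ n σ) ≡ σ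
  ΦΦ≡id σ∈ = Involution.Φ-involutive (perms-∈⁻ n σ∈)
  Φ-selected : ∀ {σ} → σ ∈ perms n → selected p213 (Φ n σ) ≡ selected p132 σ
  Φ-selected σ∈ = let open Involution (perms-∈⁻ n σ∈) in
    cong₂ _∧_ Φ-isDRS (cong₂ _∧_ (cong (_≡ᵇ nExc) Φ-exc) (cong (_≡ᵇ nFix) Φ-fix))
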